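{- For all integers $m\ge 2$ and $n\ge 1$, $\chi_{la}(K_{2n}\vee C_{2m-1})=2n+3$.
   Context: For a connected graph $H=(V,E)$, a local antimagic labeling is a bijection $f:E\to\{1,\dots,|E|\}$ such that $f^+(x)\neq f^+(y)$ for every pair of adjacent vertices $x,y$, where $f^+(x)=\sum_{e\in E(x)}f(e)$ is the sum of labels of edges incident to $x$. The local antimagic chromatic number $\chi_{la}(H)$ is the minimum number of distinct values of $f^+$ over all local antimagic labelings $f$ of $H$. $C_k$ is the cycle of order $k$, $K_k$ is the complete graph of order $k$, and $G\vee H$ is the join of $G$ and $H$ (disjoint union plus all edges between $V(G)$ and $V(H)$). -}

module Defs where

open import Data.Nat using (ℕ; zero; suc; _+_; _*_; _∸_; _≟_; _≤_)
open import Data.Nat.Properties using ()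
open import Data.Fin using (Fin; toℕ)
open import Data.Fin.Permutation using (Permutation′; _⟨$⟩ʳ_)
open import Data.List using (List; []; _∷_; _++_; map; concatMap; upTo; length; lookup; deduplicate; allFin)
open import Data.Nat.ListAction using (sum)
open import Data.Product using (_×_; _,_; proj₁; proj₂; Σ)
open import Data.Bool using (Bool; true; false; if_then_else_; _∨_)
open import Relation.Nullary using (¬_)
open import Relation.Nullary.Decidable using (⌊_⌋)
open import Relation.Binary.PropositionalEquality using (_≡_)

-- A finite (simple) graph: vertices 0 … V-1, edges given as a list of
-- unordered pairs {x , y} (each edge listed exactly once).
record Graph : Set where
  constructor mkGraph
  field
    V     : ℕ
    edges : List (ℕ × ℕ)
open Graph public

K : ℕ → Graph
K k = mkGraph k (concatMap (λ j → map (λ i → (i , j)) (upTo j)) (upTo k))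

C : ℕ → Graph
C k = mkGraph k (map (λ i → (i , suc i)) (upTo (k ∸ 1)) ++ ((k ∸ 1 , 0) ∷ []))

-- Join G ∨ H: vertices of H shifted by V G; all edges between the two parts added.
join : Graph → Graph → Graph
join G H = mkGraph (V G + V H)
  (edges G
   ++ map (λ e → (V G + proj₁ e , V G + proj₂ e)) (edges H)
   ++ concatMap (λ i → map (λ j → (i , V G + j)) (upTo (V H))) (upTo (V G)))

E : Graph → ℕ
E G = length (edges G)

edge : (G : Graph) → Fin (E G) → ℕ × ℕ
edge G k = lookup (edges G) k

-- A labeling is a bijection f : E → {1, …, |E|}; represented by a permutation σ
-- of Fin |E|, with f(k) = toℕ (σ k) + 1.
Labeling : Graph → Set
Labeling G = Permutation′ (E G)

label : (G : Graph) → Labeling G → Fin (E G) → ℕ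
label G σ k = suc (toℕ (σ ⟨$⟩ʳ k))

incident : ℕ → ℕ × ℕ → Bool
incident x (a , b) = ⌊ x ≟ a ⌋ ∨ ⌊ x ≟ b ⌋

vsum : (G : Graph) → Labeling G → ℕ → ℕ
vsum G σ x = sum (map (λ k → if incident x (edge G k) then label G σ k else 0) (allFin (E G)))

IsLocalAntimagic : (G : Graph) → Labeling G → Set
IsLocalAntimagic G σ = (k : Fin (E G)) →
  ¬ (vsum G σ (proj₁ (edge G k)) ≡ vsum G σ (proj₂ (edge G k)))

numColors : (G : Graph) → Labeling G → ℕ
numColors G σ = length (deduplicate _≟_ (map (vsum G σ) (upTo (V G))))

ChiLa : Graph → ℕ → Set
ChiLa G c =
  Σ (Labeling G) (λ σ → IsLocalAntimagic G σ × numColors G σ ≡ c)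
  × ((σ : Labeling G) → IsLocalAntimagic G σ → c ≤ numColors G σ)

-- Write N = 2n and k = 2m − 1 = 2p + 1, with the clique on the vertices 0 … N−1 and the
-- cycle on N … N+k−1.
--
-- Lower bound: the clique vertices are adjacent to each other and to every cycle vertex,
-- so their N sums are distinct and differ from all cycle sums, and an odd cycle cannot be
-- properly coloured with two values; hence at least N + 3 distinct sums.
--
-- Upper bound: give the cycle edges the labels k, 1, k−1, 2, … in order around the cycle, the
-- join edges the labels k+1 … k+Nk by filling an N × k grid row by row in alternating
-- directions, and the clique edges the largest labels. Two consecutive rows of the grid have
-- constant column sums, so every cycle vertex receives the same total from the join edges,
-- and the cycle labels give the cycle vertices only the sums k+m, k+1, k, alternating
-- properly around the cycle. Each clique vertex has a larger join-row sum than the previous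
-- one and no smaller clique sum, and already the smallest clique-vertex sum exceeds every
-- cycle-vertex sum; so exactly N + 3 values occur.

module Submission where

open import Defs

open import Data.Nat using (ℕ; zero; suc; _≡ᵇ_; _+_; _*_; _∸_; _≤_; _<_; z≤n; s≤s; _≟_; _<?_)
open import Data.Nat.Properties
open import Data.Nat.DivMod using (_/_; _%_; m<n*o⇒m/o<n; m%n<n; m≡m%n+[m/n]*n)
open import Data.Bool using (Bool; true; false; if_then_else_; _∨_)
open import Data.Bool.Properties using (∨-identityʳ; ∨-zeroʳ)
open import Data.List using (List; []; _∷_; _++_; map; concatMap; upTo; applyUpTo; length; deduplicate; lookup; allFin; tabulate)
open import Data.List.Properties
  using (map-++; map-applyUpTo; map-cong; map-tabulate; map-∘; tabulate-lookup; length-map; length-upTo; length-++)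
open import Data.Nat.ListAction using (sum)
open import Data.Nat.ListAction.Properties using (sum-++)
open import Data.Product using (_×_; _,_; proj₁; proj₂; ∃; Σ)
open import Data.Sum using (_⊎_; inj₁; inj₂)
open import Data.Empty using (⊥-elim)
open import Relation.Nullary using (yes; no; contradiction)
open import Relation.Nullary.Decidable using (dec-true; dec-false; isYes≗does)
open import Relation.Binary.PropositionalEquality
open import Function using (_∘_; id)
open import Function.Definitions using (Injective)
open import Data.Nat.Tactic.RingSolver using (solve-∀)
open import Algebra.Properties.CommutativeSemigroup +-commutativeSemigroup using (interchange)
open import Data.List.Membership.Propositional using (_∈_)
open import Data.List.Membership.Propositional.Properties
  using (∈-map⁺; ∈-map⁻; ∈-concat⁺′; ∈-concat⁻′; ∈-lookup; ∈-++⁺ˡ; ∈-++⁺ʳ; ∈-++⁻; ∈-upTo⁺; ∈-upTo⁻;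
         ∈-deduplicate⁺; ∈-deduplicate⁻)
open import Data.List.Relation.Binary.Subset.Propositional using (_⊆_)
open import Data.List.Relation.Unary.Any using (here; there)
import Data.List.Relation.Unary.Any as Any
open import Data.List.Relation.Unary.Any.Properties using (lookup-index)
open import Data.List.Relation.Unary.All using ([]; _∷_)
import Data.List.Relation.Unary.All as All
open import Data.List.Relation.Unary.AllPairs using ([]; _∷_)
open import Data.List.Relation.Unary.Unique.Propositional using (Unique)
import Data.List.Relation.Unary.Unique.Propositional.Properties as UniqueP
open import Data.List.Relation.Binary.Disjoint.Propositional using (Disjoint)
open import Data.List.Relation.Unary.Unique.DecPropositional.Properties using (deduplicate-!)
open import Data.Fin as Fin using (Fin)
import Data.Fin.Properties as Fin
open import Data.Fin.Permutation using (Permutation′; permutation)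

injective⇒surjective : ∀ {q} (f : Fin q → Fin q) → Injective _≡_ _≡_ f → ∀ y → ∃ λ x → f x ≡ y
injective⇒surjective {zero} f f-inj ()
injective⇒surjective {suc q} f f-inj y with Fin.any? (λ x → f x Fin.≟ y)
... | yes hit = hit
... | no miss = ⊥-elim (1+n≰n (Fin.injective⇒≤ g-inj))
  where
  f≢y : ∀ x → f x ≢ y
  f≢y x e = miss (x , e)
  g : Fin (suc q) → Fin q
  g x = Fin.punchOut (f≢y x ∘ sym)
  g-inj : Injective _≡_ _≡_ g
  g-inj {a} {b} e = f-inj (Fin.punchOut-injective (f≢y a ∘ sym) (f≢y b ∘ sym) e)

rightInverse⇒permutation : ∀ {q} (f g : Fin q → Fin q) → (∀ y → f (g y) ≡ y) → Permutation′ q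
rightInverse⇒permutation f g fg = permutation f g fg gf
  where
  g-inj : Injective _≡_ _≡_ g
  g-inj {a} {b} e = trans (sym (fg a)) (trans (cong f e) (fg b))
  gf : ∀ x → g (f x) ≡ x
  gf x with injective⇒surjective g g-inj x
  ... | y , refl = cong g (fg y)

∑ : ℕ → (ℕ → ℕ) → ℕ
∑ zero    f = 0
∑ (suc L) f = f 0 + ∑ L (f ∘ suc)

syntax ∑ L (λ i → e) = ∑[ i < L ] e

∑-cong : ∀ L {f g} → (∀ {i} → i < L → f i ≡ g i) → ∑ L f ≡ ∑ L g
∑-cong zero    eq = refl
∑-cong (suc L) eq = cong₂ _+_ (eq (s≤s z≤n)) (∑-cong L (eq ∘ s≤s))

∑-split : ∀ L M f → ∑ (L + M) f ≡ ∑ L f + ∑[ i < M ] f (L + i)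
∑-split zero    M f = refl
∑-split (suc L) M f = trans (cong (f 0 +_) (∑-split L M (f ∘ suc))) (sym (+-assoc (f 0) _ _))

∑-last : ∀ L f → ∑ (suc L) f ≡ ∑ L f + f L
∑-last zero    f = +-comm (f 0) 0
∑-last (suc L) f = trans (cong (f 0 +_) (∑-last L (f ∘ suc))) (sym (+-assoc (f 0) _ _))

∑-const : ∀ L c → ∑[ i < L ] c ≡ L * c
∑-const zero    c = refl
∑-const (suc L) c = cong (c +_) (∑-const L c)

∑-vanish : ∀ L {f} → (∀ {i} → i < L → f i ≡ 0) → ∑ L f ≡ 0
∑-vanish L eq = trans (∑-cong L eq) (trans (∑-const L 0) (*-zeroʳ L))

∑-distrib-+ : ∀ L f g → ∑[ i < L ] (f i + g i) ≡ ∑ L f + ∑ L g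
∑-distrib-+ zero    f g = refl
∑-distrib-+ (suc L) f g =
  trans (cong (f 0 + g 0 +_) (∑-distrib-+ L (f ∘ suc) (g ∘ suc))) (interchange (f 0) (g 0) _ _)

∑-pairs : ∀ n f → ∑ (n + n) f ≡ ∑[ t < n ] (f (t + t) + f (suc (t + t)))
∑-pairs zero    f = refl
∑-pairs (suc n) f = begin
  f 0 + ∑ (n + suc n) (f ∘ suc)                         ≡⟨ cong (λ L → f 0 + ∑ L (f ∘ suc)) (+-suc n n) ⟩
  f 0 + (f 1 + ∑ (n + n) (f ∘ suc ∘ suc))               ≡⟨ sym (+-assoc (f 0) (f 1) _) ⟩
  f 0 + f 1 + ∑ (n + n) (f ∘ suc ∘ suc)                 ≡⟨ cong (f 0 + f 1 +_) (∑-pairs n (f ∘ suc ∘ suc)) ⟩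
  f 0 + f 1 + ∑[ t < n ] (f (2 + (t + t)) + f (3 + (t + t)))
    ≡⟨ cong (f 0 + f 1 +_) (∑-cong n λ {t} _ → cong₂ (λ u v → f u + f v) (2+t+t t) (cong suc (2+t+t t))) ⟩
  f 0 + f 1 + ∑[ t < n ] (f (suc t + suc t) + f (suc (suc t + suc t))) ∎
  where
  open ≡-Reasoning
  2+t+t : ∀ t → 2 + (t + t) ≡ suc t + suc t
  2+t+t t = cong suc (sym (+-suc t t))

∑-mono-≤ : ∀ L {f g} → (∀ {i} → i < L → f i ≤ g i) → ∑ L f ≤ ∑ L g
∑-mono-≤ zero    le = z≤n
∑-mono-≤ (suc L) le = +-mono-≤ (le (s≤s z≤n)) (∑-mono-≤ L (le ∘ s≤s))

∑-mono-< : ∀ L {f g} → 0 < L → (∀ {i} → i < L → f i < g i) → ∑ L f < ∑ L g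
∑-mono-< (suc L) _ lt = +-mono-<-≤ (lt (s≤s z≤n)) (∑-mono-≤ L (<⇒≤ ∘ lt ∘ s≤s))

*≤∑ : ∀ L c {f} → (∀ {i} → i < L → c ≤ f i) → L * c ≤ ∑ L f
*≤∑ L c le = subst (_≤ _) (∑-const L c) (∑-mono-≤ L le)

∑≤* : ∀ L c {f} → (∀ {i} → i < L → f i ≤ c) → ∑ L f ≤ L * c
∑≤* L c le = subst (_ ≤_) (∑-const L c) (∑-mono-≤ L le)

when : Bool → ℕ → ℕ
when b v = if b then v else 0

∑-when : ∀ L b (f : ℕ → ℕ) → ∑[ i < L ] when b (f i) ≡ when b (∑ L f)
∑-when L true  f = refl
∑-when L false f = trans (∑-const L 0) (*-zeroʳ L)

-- Indicators use _≡ᵇ_ rather than ⌊ _ ≟ _ ⌋: only the former reduces on suc y and suc i.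
∑-indicator : ∀ L {y} (f : ℕ → ℕ) → y < L → ∑[ i < L ] when (y ≡ᵇ i) (f i) ≡ f y
∑-indicator (suc L) {zero}  f _         = trans (cong (f 0 +_) (∑-vanish L (λ _ → refl))) (+-identityʳ (f 0))
∑-indicator (suc L) {suc y} f (s≤s y<L) = ∑-indicator L {y} (f ∘ suc) y<L

when-∨ : ∀ {x a b} v → a ≢ b → when ((x ≡ᵇ a) ∨ (x ≡ᵇ b)) v ≡ when (x ≡ᵇ a) v + when (x ≡ᵇ b) v
when-∨ {x} {a} {b} v a≢b with x ≟ a
... | yes refl rewrite dec-true (x ≟ x) refl | dec-false (x ≟ b) a≢b = sym (+-identityʳ v)
... | no  x≢a  rewrite dec-false (x ≟ a) x≢a = refl

≡ᵇ-+ : ∀ N x y → (N + x ≡ᵇ N + y) ≡ (x ≡ᵇ y)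
≡ᵇ-+ zero    x y = refl
≡ᵇ-+ (suc N) x y = ≡ᵇ-+ N x y

sum-map-applyUpTo : {A : Set} (g : A → ℕ) (f : ℕ → A) (L : ℕ) → sum (map g (applyUpTo f L)) ≡ ∑[ i < L ] g (f i)
sum-map-applyUpTo g f zero    = refl
sum-map-applyUpTo g f (suc L) = cong (g (f 0) +_) (sum-map-applyUpTo g (f ∘ suc) L)

sum-map-map-upTo : {A : Set} (w : A → ℕ) (f : ℕ → A) (L : ℕ) → sum (map w (map f (upTo L))) ≡ ∑[ i < L ] w (f i)
sum-map-map-upTo w f L = trans (cong (sum ∘ map w) (map-applyUpTo id f L)) (sum-map-applyUpTo w f L)

sum-map-++ : {A : Set} (g : A → ℕ) (xs ys : List A) → sum (map g (xs ++ ys)) ≡ sum (map g xs) + sum (map g ys)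
sum-map-++ g xs ys = trans (cong sum (map-++ g xs ys)) (sum-++ (map g xs) _)

sum-map-concatMap : {A B : Set} (g : B → ℕ) (h : A → List B) (xs : List A) →
  sum (map g (concatMap h xs)) ≡ sum (map (λ a → sum (map g (h a))) xs)
sum-map-concatMap g h []       = refl
sum-map-concatMap g h (x ∷ xs) =
  trans (sum-map-++ g (h x) (concatMap h xs)) (cong (sum (map g (h x)) +_) (sum-map-concatMap g h xs))

∈-remove : ∀ {x : ℕ} {ys} → x ∈ ys →
  ∃ λ zs → length ys ≡ suc (length zs) × (∀ {y} → y ∈ ys → y ≢ x → y ∈ zs)
∈-remove {ys = y ∷ ys} (here refl) = ys , refl , λ { (here e) y≢x → ⊥-elim (y≢x e) ; (there m) _ → m }
∈-remove {ys = y ∷ ys} (there x∈ys) with ∈-remove x∈ys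
... | zs , len , keep = y ∷ zs , cong suc len , λ { (here e) _ → here e ; (there m) y≢x → there (keep m y≢x) }

unique-⊆⇒length≤ : {xs ys : List ℕ} → Unique xs → xs ⊆ ys → length xs ≤ length ys
unique-⊆⇒length≤ {[]}     _            _   = z≤n
unique-⊆⇒length≤ {x ∷ xs} (x∉xs ∷ uxs) sub with ∈-remove (sub (here refl))
... | zs , len , keep = subst (suc (length xs) ≤_) (sym len)
  (s≤s (unique-⊆⇒length≤ uxs λ m → keep (sub (there m)) λ { refl → All.lookup x∉xs m refl }))

distinctValues : (ℕ → ℕ) → ℕ → ℕ
distinctValues f L = length (deduplicate _≟_ (map f (upTo L)))

distinctValues-≤ : ∀ f L {xs : List ℕ} → (∀ {v} → v < L → f v ∈ xs) → distinctValues f L ≤ length xs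
distinctValues-≤ f L cover = unique-⊆⇒length≤ (deduplicate-! _≟_ (map f (upTo L))) λ m →
  let v , v∈ , eq = ∈-map⁻ f (∈-deduplicate⁻ _≟_ (map f (upTo L)) m) in subst (_∈ _) (sym eq) (cover (∈-upTo⁻ v∈))

distinctValues-≥ : ∀ f L {xs : List ℕ} → Unique xs → (∀ {y} → y ∈ xs → ∃ λ v → v < L × f v ≡ y) →
  length xs ≤ distinctValues f L
distinctValues-≥ f L uxs attained = unique-⊆⇒length≤ {ys = deduplicate _≟_ (map f (upTo L))} uxs λ m →
  let v , v<L , eq = attained m in ∈-deduplicate⁺ _≟_ (subst (_∈ _) eq (∈-map⁺ f (∈-upTo⁺ v<L)))

oddCycle-thirdValue : ∀ (g : ℕ → ℕ) p → (∀ {i} → i < p + p → g i ≢ g (suc i)) → g (p + p) ≢ g 0 →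
  ∃ λ y → y < suc (p + p) × g y ≢ g 0 × g y ≢ g 1
oddCycle-thirdValue g p proper closing with alternate p ≤-refl
  where
  Third : Set
  Third = ∃ λ y → y < suc (p + p) × g y ≢ g 0 × g y ≢ g 1
  alternate : ∀ t → t ≤ p → Third ⊎ g (t + t) ≡ g 0
  alternate zero    _    = inj₂ refl
  alternate (suc t) t<p with alternate t (<⇒≤ t<p)
  ... | inj₁ third = inj₁ third
  ... | inj₂ even with g (suc (t + t)) ≟ g 1
  ... | no odd≢ = inj₁ (suc (t + t) , s≤s i₁ , (λ e → proper i₁ (trans even (sym e))) , odd≢)
    where
    i₁ : t + t < p + p
    i₁ = +-mono-< t<p t<p
  ... | yes odd with g (suc (suc (t + t))) ≟ g 0
  ... | yes even′ = inj₂ (trans (cong (g ∘ suc) (+-suc t t)) even′)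
  ... | no even≢ = inj₁ (suc (suc (t + t)) , s≤s i₂ , even≢ , (λ e → proper i₂ (trans odd (sym e))))
    where
    i₂ : suc (t + t) < p + p
    i₂ = subst (_≤ p + p) (cong suc (+-suc t t)) (+-mono-≤ t<p t<p)
... | inj₁ third = third
... | inj₂ even  = ⊥-elim (closing even)

-- f is a vertex function on K_N ∨ C_k, the clique on 0 … N−1 and the cycle on N … N+k−1.
module CliqueJoinCycle (f : ℕ → ℕ) (N k : ℕ) where

  clique : List ℕ
  clique = map f (upTo N)

  length-++-clique : ∀ xs → length (xs ++ clique) ≡ N + length xs
  length-++-clique xs = begin
    length (xs ++ clique)        ≡⟨ length-++ xs ⟩
    length xs + length clique    ≡⟨ cong (length xs +_) (trans (length-map f (upTo N)) (length-upTo N)) ⟩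
    length xs + N                ≡⟨ +-comm (length xs) N ⟩
    N + length xs                ∎
    where open ≡-Reasoning

  distinctValues-≤N+3 : (∀ {y} → y < k → f (N + y) ∈ f (N + 0) ∷ f (N + 1) ∷ f (N + 2) ∷ []) →
    distinctValues f (N + k) ≤ N + 3
  distinctValues-≤N+3 three =
    ≤-trans (distinctValues-≤ f (N + k) cover) (≤-reflexive (length-++-clique (f (N + 0) ∷ f (N + 1) ∷ f (N + 2) ∷ [])))
    where
    cover : ∀ {v} → v < N + k → f v ∈ (f (N + 0) ∷ f (N + 1) ∷ f (N + 2) ∷ []) ++ clique
    cover {v} v<N+k with v <? N
    ... | yes v<N = ∈-++⁺ʳ _ (∈-map⁺ f (∈-upTo⁺ v<N))
    ... | no  v≮N = subst (λ u → f u ∈ _) (m+[n∸m]≡n N≤v) (∈-++⁺ˡ (three v∸N<k))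
      where
      N≤v : N ≤ v
      N≤v = ≮⇒≥ v≮N
      v∸N<k : v ∸ N < k
      v∸N<k = subst (v ∸ N <_) (m+n∸m≡n N k) (∸-monoˡ-< v<N+k N≤v)

  N+3≤distinctValues : ∀ {y₁ y₂ y₃} → y₁ < k → y₂ < k → y₃ < k →
    (∀ {i j} → i < j → j < N → f i ≢ f j) → (∀ {i y} → i < N → y < k → f i ≢ f (N + y)) →
    Unique (f (N + y₁) ∷ f (N + y₂) ∷ f (N + y₃) ∷ []) → N + 3 ≤ distinctValues f (N + k)
  N+3≤distinctValues {y₁} {y₂} {y₃} y₁<k y₂<k y₃<k clique-proper join-proper cycle-distinct =
    ≤-trans (≤-reflexive (sym (length-++-clique cycleValues))) (distinctValues-≥ f (N + k) unique attained)
    where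
    cycleValues : List ℕ
    cycleValues = f (N + y₁) ∷ f (N + y₂) ∷ f (N + y₃) ∷ []
    fromCycle : ∀ {v} → v ∈ cycleValues → ∃ λ y → y < k × v ≡ f (N + y)
    fromCycle (here e)                 = y₁ , y₁<k , e
    fromCycle (there (here e))         = y₂ , y₂<k , e
    fromCycle (there (there (here e))) = y₃ , y₃<k , e
    disjoint : Disjoint cycleValues clique
    disjoint (c , d) with fromCycle c | ∈-map⁻ f d
    ... | y , y<k , refl | i , i∈ , e = join-proper (∈-upTo⁻ i∈) y<k (sym e)
    unique : Unique (cycleValues ++ clique)
    unique = UniqueP.++⁺ cycle-distinct clique-unique disjoint
      where
      clique-unique : Unique clique
      clique-unique = subst Unique (sym (map-applyUpTo id f N)) (UniqueP.applyUpTo⁺₁ f N clique-proper)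
    attained : ∀ {y} → y ∈ cycleValues ++ clique → ∃ λ v → v < N + k × f v ≡ y
    attained m with ∈-++⁻ cycleValues m
    ... | inj₁ c = let y , y<k , e = fromCycle c in N + y , +-monoʳ-< N y<k , sym e
    ... | inj₂ d = let i , i∈ , e = ∈-map⁻ f d in i , <-≤-trans (∈-upTo⁻ i∈) (m≤m+n N k) , sym e

zigzag : ℕ → ℕ → ℕ → ℕ
zigzag a b zero          = a
zigzag a b (suc zero)    = b
zigzag a b (suc (suc i)) = zigzag (a ∸ 1) (suc b) i

parity : ℕ → ℕ
parity zero          = 0
parity (suc zero)    = 1
parity (suc (suc i)) = parity i

parity-view : ∀ i → ∃ λ t → i ≡ t + t ⊎ i ≡ suc (t + t)
parity-view zero = 0 , inj₁ refl
parity-view (suc i) with parity-view i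
... | t , inj₁ refl = t , inj₂ refl
... | t , inj₂ refl = suc t , inj₁ (cong suc (sym (+-suc t t)))

parity-0⊎1 : ∀ i → parity i ≡ 0 ⊎ parity i ≡ 1
parity-0⊎1 zero          = inj₁ refl
parity-0⊎1 (suc zero)    = inj₂ refl
parity-0⊎1 (suc (suc i)) = parity-0⊎1 i

parity-+-suc : ∀ i → parity i + parity (suc i) ≡ 1
parity-+-suc zero          = refl
parity-+-suc (suc zero)    = refl
parity-+-suc (suc (suc i)) = parity-+-suc i

zigzag-even : ∀ t a b → zigzag a b (t + t) ≡ a ∸ t
zigzag-even zero    a b = refl
zigzag-even (suc t) a b rewrite +-suc t t = trans (zigzag-even t (a ∸ 1) (suc b)) (∸-+-assoc a 1 t)

zigzag-odd : ∀ t a b → zigzag a b (suc (t + t)) ≡ b + t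
zigzag-odd zero    a b = sym (+-identityʳ b)
zigzag-odd (suc t) a b rewrite +-suc t t = trans (zigzag-odd t (a ∸ 1) (suc b)) (sym (+-suc b t))

zigzag-adjacent : ∀ a b {z} → z < a + a → zigzag a b z + zigzag a b (suc z) + parity z ≡ a + b
zigzag-adjacent a       b {zero}          _ = +-identityʳ (a + b)
zigzag-adjacent (suc a) b {suc zero}      _ = trans (+-comm (b + a) 1) (cong suc (+-comm b a))
zigzag-adjacent (suc a) b {suc (suc z)} z<a+a =
  trans (zigzag-adjacent a (suc b) (≤-pred (subst (suc (suc z) ≤_) (+-suc a a) (≤-pred z<a+a)))) (+-suc a b)

-- Entry (i , j) of the numbering 1, 2, … of a grid with k columns, row i read from the left
-- if i is even and from the right if i is odd.
boustrophedon : ℕ → ℕ → ℕ → ℕ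
boustrophedon k zero          j = suc j
boustrophedon k (suc zero)    j = k + k ∸ j
boustrophedon k (suc (suc i)) j = k + k + boustrophedon k i j

boustrophedon-even : ∀ k t j → boustrophedon k (t + t) j ≡ (t + t) * k + suc j
boustrophedon-even k zero    j = refl
boustrophedon-even k (suc t) j rewrite +-suc t t =
  trans (cong (k + k +_) (boustrophedon-even k t j)) (two-rows k t (suc j))
  where
  two-rows : ∀ k t s → k + k + ((t + t) * k + s) ≡ suc (suc (t + t)) * k + s
  two-rows = solve-∀

boustrophedon-odd : ∀ k t j → boustrophedon k (suc (t + t)) j ≡ (t + t) * k + (k + k ∸ j)
boustrophedon-odd k zero    j = refl
boustrophedon-odd k (suc t) j rewrite +-suc t t =
  trans (cong (k + k +_) (boustrophedon-odd k t j)) (two-rows k t (k + k ∸ j))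
  where
  two-rows : ∀ k t s → k + k + ((t + t) * k + s) ≡ suc (suc (t + t)) * k + s
  two-rows = solve-∀

boustrophedon-≤ : ∀ k i {j} → j < k → boustrophedon k i j ≤ suc i * k
boustrophedon-≤ k zero          j<k = subst (_ ≤_) (sym (+-identityʳ k)) j<k
boustrophedon-≤ k (suc zero) {j} j<k = ≤-trans (m∸n≤m (k + k) j) (≤-reflexive (cong (k +_) (sym (+-identityʳ k))))
boustrophedon-≤ k (suc (suc i)) j<k = ≤-trans (+-monoʳ-≤ (k + k) (boustrophedon-≤ k i j<k)) (≤-reflexive (+-assoc k k _))

boustrophedon-< : ∀ k i {j} → j < k → boustrophedon k i j < boustrophedon k (suc i) j
boustrophedon-< k zero {j} j<k = begin-strict
  suc j            ≡⟨ sym (+-identityʳ (suc j)) ⟩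
  suc j + 0        <⟨ +-mono-≤-< j<k (m<n⇒0<n∸m j<k) ⟩
  k + (k ∸ j)      ≡⟨ sym (+-∸-assoc k (<⇒≤ j<k)) ⟩
  k + k ∸ j        ∎
  where open ≤-Reasoning
boustrophedon-< k (suc zero) {j} j<k =
  ≤-trans (s≤s (≤-trans (m∸n≤m (k + k) j) (m≤m+n (k + k) j))) (≤-reflexive (sym (+-suc (k + k) j)))
boustrophedon-< k (suc (suc i)) j<k = +-monoʳ-< (k + k) (boustrophedon-< k i j<k)

boustrophedon-decode : ∀ k i {r} → r < k → ∃ λ j → j < k × boustrophedon k i j ≡ i * k + suc r
boustrophedon-decode k zero {r} r<k = r , r<k , refl
boustrophedon-decode k (suc zero) {r} r<k = k ∸ suc r , ∸-monoʳ-< {k} (s≤s z≤n) r<k , (begin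
  k + k ∸ (k ∸ suc r)    ≡⟨ +-∸-assoc k (m∸n≤m k (suc r)) ⟩
  k + (k ∸ (k ∸ suc r))  ≡⟨ cong (k +_) (m∸[m∸n]≡n r<k) ⟩
  k + suc r              ≡⟨ cong (_+ suc r) (sym (+-identityʳ k)) ⟩
  (k + 0) + suc r        ∎)
  where open ≡-Reasoning
boustrophedon-decode k (suc (suc i)) {r} r<k with boustrophedon-decode k i r<k
... | j , j<k , eq = j , j<k , trans (cong (k + k +_) eq) (two-rows k i (suc r))
  where
  two-rows : ∀ k i s → k + k + (i * k + s) ≡ suc (suc i) * k + s
  two-rows = solve-∀

triangle : ℕ → ℕ
triangle zero    = 0
triangle (suc j) = triangle j + j

∑-id : ∀ M → ∑[ j < M ] j ≡ triangle M
∑-id zero    = refl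
∑-id (suc M) = trans (∑-last M id) (cong (_+ M) (∑-id M))

triangle-mono : ∀ {a b} → a ≤ b → triangle a ≤ triangle b
triangle-mono {b = zero}      z≤n = ≤-refl
triangle-mono {a} {suc b} a≤1+b with m≤n⇒m<n∨m≡n a≤1+b
... | inj₁ a<1+b = ≤-trans (triangle-mono (≤-pred a<1+b)) (m≤m+n (triangle b) b)
... | inj₂ refl  = ≤-refl

triangle-+-< : ∀ {i j N} → i < j → j < N → triangle j + i < triangle N
triangle-+-< {i} {j} i<j j<N = <-≤-trans (+-monoʳ-< (triangle j) i<j) (triangle-mono j<N)

triangle-decode : ∀ M {v} → v < triangle M → ∃ λ j → ∃ λ i → i < j × j < M × triangle j + i ≡ v
triangle-decode (suc M) {v} v<T with v <? triangle M
... | yes v<T′ = let j , i , i<j , j<M , eq = triangle-decode M v<T′ in j , i , i<j , m<n⇒m<1+n j<M , eq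
... | no  v≮T′ = M , v ∸ triangle M , v∸T<M , n<1+n M , m+[n∸m]≡n (≮⇒≥ v≮T′)
  where
  v∸T<M : v ∸ triangle M < M
  v∸T<M = subst (v ∸ triangle M <_) (m+n∸m≡n (triangle M) M) (∸-monoˡ-< v<T (≮⇒≥ v≮T′))

rows : {A : Set} → ℕ → (ℕ → ℕ) → (ℕ → ℕ → A) → List A
rows L h g = concatMap (λ j → map (g j) (upTo (h j))) (upTo L)

sum-map-rows : {A : Set} (w : A → ℕ) (L : ℕ) (h : ℕ → ℕ) (g : ℕ → ℕ → A) →
  sum (map w (rows L h g)) ≡ ∑[ j < L ] ∑[ i < h j ] w (g j i)
sum-map-rows w L h g = begin
  sum (map w (rows L h g))                              ≡⟨ sum-map-concatMap w _ (upTo L) ⟩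
  sum (map (λ j → sum (map w (map (g j) (upTo (h j))))) (upTo L))
    ≡⟨ sum-map-applyUpTo _ id L ⟩
  ∑[ j < L ] sum (map w (map (g j) (upTo (h j))))
    ≡⟨ ∑-cong L (λ {j} _ → sum-map-map-upTo w (g j) (h j)) ⟩
  ∑[ j < L ] ∑[ i < h j ] w (g j i)                     ∎
  where open ≡-Reasoning

length-rows : {A : Set} (L : ℕ) (h : ℕ → ℕ) (g : ℕ → ℕ → A) → length (rows L h g) ≡ ∑ L h
length-rows L h g = begin
  length (rows L h g)                    ≡⟨ sym (sum-map-const (rows L h g)) ⟩
  sum (map (λ _ → 1) (rows L h g))       ≡⟨ sum-map-rows (λ _ → 1) L h g ⟩
  ∑[ j < L ] ∑[ i < h j ] 1              ≡⟨ ∑-cong L (λ {j} _ → trans (∑-const (h j) 1) (*-identityʳ (h j))) ⟩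
  ∑ L h                                  ∎
  where
  open ≡-Reasoning
  sum-map-const : ∀ {A : Set} (xs : List A) → sum (map (λ _ → 1) xs) ≡ length xs
  sum-map-const []       = refl
  sum-map-const (_ ∷ xs) = cong suc (sum-map-const xs)

∈-rows⁺ : {A : Set} {L : ℕ} {h : ℕ → ℕ} (g : ℕ → ℕ → A) {j i : ℕ} → j < L → i < h j → g j i ∈ rows L h g
∈-rows⁺ {h = h} g {j} j<L i<h =
  ∈-concat⁺′ (∈-map⁺ (g j) (∈-upTo⁺ i<h)) (∈-map⁺ (λ j → map (g j) (upTo (h j))) (∈-upTo⁺ j<L))

∈-rows⁻ : {A : Set} {L : ℕ} {h : ℕ → ℕ} (g : ℕ → ℕ → A) {e : A} → e ∈ rows L h g →
  ∃ λ j → ∃ λ i → j < L × i < h j × e ≡ g j i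
∈-rows⁻ {L = L} {h} g m with ∈-concat⁻′ (map (λ j → map (g j) (upTo (h j))) (upTo L)) m
... | row , e∈row , row∈ with ∈-map⁻ (λ j → map (g j) (upTo (h j))) row∈
... | j , j∈ , refl with ∈-map⁻ (g j) e∈row
... | i , i∈ , refl = j , i , ∈-upTo⁻ j∈ , ∈-upTo⁻ i∈ , refl

labeling-fromEdgeLabels : (G : Graph) (ℓ : ℕ × ℕ → ℕ) →
  (∀ {e} → e ∈ edges G → 0 < ℓ e × ℓ e ≤ E G) →
  (∀ {w} → 0 < w → w ≤ E G → ∃ λ e → e ∈ edges G × ℓ e ≡ w) →
  Σ (Labeling G) λ σ → ∀ x → label G σ x ≡ ℓ (edge G x)
labeling-fromEdgeLabels G ℓ range onto = σ , label-σ
  where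
  pred-< : ∀ {a q} → 0 < a → a ≤ q → a ∸ 1 < q
  pred-< {suc a} _ a≤q = a≤q
  suc-∸1 : ∀ {a} → 0 < a → suc (a ∸ 1) ≡ a
  suc-∸1 {suc a} _ = refl
  range′ : ∀ x → 0 < ℓ (edge G x) × ℓ (edge G x) ≤ E G
  range′ x = range (∈-lookup x)
  f : Fin (E G) → Fin (E G)
  f x = Fin.fromℕ< (pred-< (proj₁ (range′ x)) (proj₂ (range′ x)))
  preimage : ∀ (v : Fin (E G)) → ∃ λ e → e ∈ edges G × ℓ e ≡ suc (Fin.toℕ v)
  preimage v = onto (s≤s z≤n) (Fin.toℕ<n v)
  g : Fin (E G) → Fin (E G)
  g v = Any.index (proj₁ (proj₂ (preimage v)))
  f∘g : ∀ v → f (g v) ≡ v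
  f∘g v = Fin.toℕ-injective (trans (Fin.toℕ-fromℕ< _)
    (cong (_∸ 1) (trans (cong ℓ (sym (lookup-index e∈))) ℓe≡)))
    where
    e∈ = proj₁ (proj₂ (preimage v))
    ℓe≡ = proj₂ (proj₂ (preimage v))
  σ : Labeling G
  σ = rightInverse⇒permutation f g f∘g
  label-σ : ∀ x → label G σ x ≡ ℓ (edge G x)
  label-σ x = trans (cong suc (Fin.toℕ-fromℕ< _)) (suc-∸1 (proj₁ (range′ x)))

antimagic-fromEdges : (G : Graph) (σ : Labeling G) →
  (∀ {e} → e ∈ edges G → vsum G σ (proj₁ e) ≢ vsum G σ (proj₂ e)) → IsLocalAntimagic G σ
antimagic-fromEdges G σ proper x = proper (∈-lookup x)

antimagic-onEdges : (G : Graph) (σ : Labeling G) → IsLocalAntimagic G σ →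
  ∀ {e} → e ∈ edges G → vsum G σ (proj₁ e) ≢ vsum G σ (proj₂ e)
antimagic-onEdges G σ antimagic e∈ =
  subst (λ e → vsum G σ (proj₁ e) ≢ vsum G σ (proj₂ e)) (sym (lookup-index e∈)) (antimagic (Any.index e∈))

vsum-byEdges : (G : Graph) (σ : Labeling G) (ℓ : ℕ × ℕ → ℕ) → (∀ x → label G σ x ≡ ℓ (edge G x)) →
  ∀ v → vsum G σ v ≡ sum (map (λ e → when (incident v e) (ℓ e)) (edges G))
vsum-byEdges G σ ℓ label-ℓ v = begin
  vsum G σ v
    ≡⟨ cong sum (map-cong (λ x → cong (when (incident v (edge G x))) (label-ℓ x)) (allFin (E G))) ⟩
  sum (map (weight ∘ lookup (edges G)) (allFin (E G)))
    ≡⟨ cong sum (trans (map-tabulate id _) (sym (map-tabulate (lookup (edges G)) weight))) ⟩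
  sum (map weight (tabulate (lookup (edges G))))
    ≡⟨ cong (sum ∘ map weight) (tabulate-lookup (edges G)) ⟩
  sum (map weight (edges G)) ∎
  where
  open ≡-Reasoning
  weight : ℕ × ℕ → ℕ
  weight e = when (incident v e) (ℓ e)

incident-≡ᵇ : ∀ v a b → incident v (a , b) ≡ (v ≡ᵇ a) ∨ (v ≡ᵇ b)
incident-≡ᵇ v a b = cong₂ _∨_ (isYes≗does (v ≟ a)) (isYes≗does (v ≟ b))

module Construction (n′ p′ : ℕ) where

  n p N k : ℕ
  n = suc n′
  p = suc p′
  N = n + n
  k = suc (p + p)

  G : Graph
  G = join (K N) (C k)

  shift : ℕ × ℕ → ℕ × ℕ
  shift (a , b) = (N + a , N + b)

  cyclePath cliqueEdges cycleEdges joinEdges : List (ℕ × ℕ)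
  cyclePath   = map (λ i → (i , suc i)) (upTo (p + p))
  cliqueEdges = rows N id (λ j i → (i , j))
  cycleEdges  = map shift (cyclePath ++ (p + p , 0) ∷ [])
  joinEdges   = rows N (λ _ → k) (λ i j → (i , N + j))

  E-G : E G ≡ triangle N + (k + N * k)
  E-G = begin
    length (cliqueEdges ++ (cycleEdges ++ joinEdges))
      ≡⟨ length-++ cliqueEdges ⟩
    length cliqueEdges + length (cycleEdges ++ joinEdges)
      ≡⟨ cong₂ _+_ (trans (length-rows N id _) (∑-id N)) (length-++ cycleEdges) ⟩
    triangle N + (length cycleEdges + length joinEdges)
      ≡⟨ cong (triangle N +_) (cong₂ _+_ length-cycleEdges (trans (length-rows N (λ _ → k) _) (∑-const N k))) ⟩
    triangle N + (k + N * k) ∎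
    where
    open ≡-Reasoning
    length-cycleEdges : length cycleEdges ≡ k
    length-cycleEdges = begin
      length cycleEdges                       ≡⟨ length-map shift (cyclePath ++ _) ⟩
      length (cyclePath ++ (p + p , 0) ∷ [])  ≡⟨ length-++ cyclePath ⟩
      length cyclePath + 1                    ≡⟨ cong (_+ 1) (trans (length-map _ (upTo (p + p))) (length-upTo (p + p))) ⟩
      p + p + 1                               ≡⟨ +-comm (p + p) 1 ⟩
      k                                       ∎

  cliqueEdge-∈ : ∀ {i j} → i < j → j < N → (i , j) ∈ edges G
  cliqueEdge-∈ i<j j<N = ∈-++⁺ˡ (∈-rows⁺ {L = N} {h = id} (λ j i → (i , j)) j<N i<j)

  joinEdge-∈ : ∀ {i j} → i < N → j < k → (i , N + j) ∈ edges G
  joinEdge-∈ i<N j<k =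
    ∈-++⁺ʳ cliqueEdges (∈-++⁺ʳ cycleEdges (∈-rows⁺ {L = N} {h = λ _ → k} (λ i j → (i , N + j)) i<N j<k))

  cycleEdge-∈ : ∀ {i} → i < p + p → (N + i , N + suc i) ∈ edges G
  cycleEdge-∈ i<2p =
    ∈-++⁺ʳ cliqueEdges (∈-++⁺ˡ (∈-map⁺ shift (∈-++⁺ˡ (∈-map⁺ (λ i → (i , suc i)) (∈-upTo⁺ i<2p)))))

  closingEdge-∈ : (N + (p + p) , N + 0) ∈ edges G
  closingEdge-∈ = ∈-++⁺ʳ cliqueEdges (∈-++⁺ˡ (∈-map⁺ shift (∈-++⁺ʳ cyclePath (here refl))))

  data EdgeView : ℕ × ℕ → Set where
    cliqueEdge  : ∀ {i j} → i < j → j < N → EdgeView (i , j)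
    cycleEdge   : ∀ {i} → i < p + p → EdgeView (N + i , N + suc i)
    closingEdge : EdgeView (N + (p + p) , N + 0)
    joinEdge    : ∀ {i j} → i < N → j < k → EdgeView (i , N + j)

  edgeView : ∀ {e} → e ∈ edges G → EdgeView e
  edgeView e∈ with ∈-++⁻ cliqueEdges e∈
  ... | inj₁ c with ∈-rows⁻ {L = N} {h = id} (λ j i → (i , j)) c
  ...   | j , i , j<N , i<j , refl = cliqueEdge i<j j<N
  edgeView e∈ | inj₂ e∈′ with ∈-++⁻ cycleEdges e∈′
  ... | inj₂ c with ∈-rows⁻ {L = N} {h = λ _ → k} (λ i j → (i , N + j)) c
  ...   | i , j , i<N , j<k , refl = joinEdge i<N j<k
  edgeView e∈ | inj₂ e∈′ | inj₁ c with ∈-map⁻ shift c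
  ... | e , e∈′′ , refl with ∈-++⁻ cyclePath e∈′′
  ...   | inj₂ (here refl) = closingEdge
  ...   | inj₁ c′ with ∈-map⁻ (λ i → (i , suc i)) c′
  ...     | i , i∈ , refl = cycleEdge (∈-upTo⁻ i∈)

  cliqueLabel joinLabel : ℕ → ℕ → ℕ
  cliqueLabel i j = suc (k + N * k + triangle j + i)
  joinLabel   i j = k + boustrophedon k i j

  cycleLabel : ℕ → ℕ
  cycleLabel = zigzag k 1

  edgeLabel : ℕ × ℕ → ℕ
  edgeLabel (a , b) with b <? N | a <? N
  ... | yes _ | _     = cliqueLabel a b
  ... | no  _ | yes _ = joinLabel a (b ∸ N)
  ... | no  _ | no  _ = cycleLabel (a ∸ N)

  edgeLabel-clique : ∀ i {j} → j < N → edgeLabel (i , j) ≡ cliqueLabel i j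
  edgeLabel-clique i {j} j<N with j <? N
  ... | yes _   = refl
  ... | no  j≮N = contradiction j<N j≮N

  edgeLabel-join : ∀ {i} j → i < N → edgeLabel (i , N + j) ≡ joinLabel i j
  edgeLabel-join {i} j i<N with N + j <? N | i <? N
  ... | yes N+j<N | _       = contradiction N+j<N (m+n≮m N j)
  ... | no  _     | yes _   = cong (joinLabel i) (m+n∸m≡n N j)
  ... | no  _     | no  i≮N = contradiction i<N i≮N

  edgeLabel-cycle : ∀ a b → edgeLabel (N + a , N + b) ≡ cycleLabel a
  edgeLabel-cycle a b with N + b <? N | N + a <? N
  ... | yes N+b<N | _         = contradiction N+b<N (m+n≮m N b)
  ... | no  _     | yes N+a<N = contradiction N+a<N (m+n≮m N a)
  ... | no  _     | no  _     = cong cycleLabel (m+n∸m≡n N a)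

  cycleLabel-range : ∀ {i} → i ≤ p + p → 0 < cycleLabel i × cycleLabel i ≤ k
  cycleLabel-range {i} i≤2p with parity-view i
  ... | t , inj₁ refl = subst (λ c → 0 < c × c ≤ k) (sym (zigzag-even t k 1)) (m<n⇒0<n∸m t<k , m∸n≤m k t)
    where
    t<k : t < k
    t<k = s≤s (≤-trans (m≤m+n t t) i≤2p)
  ... | t , inj₂ refl = subst (λ c → 0 < c × c ≤ k) (sym (zigzag-odd t k 1)) (s≤s z≤n , s≤s t≤2p)
    where
    t≤2p : t ≤ p + p
    t≤2p = ≤-trans (m≤m+n t t) (≤-trans (n≤1+n (t + t)) i≤2p)

  cycleLabel-onto : ∀ {w} → 0 < w → w ≤ k → ∃ λ i → i ≤ p + p × cycleLabel i ≡ w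
  cycleLabel-onto {suc t} _ w≤k with suc t ≤? p
  ... | yes t<p = suc (t + t) , +-mono-< t<p t<p , zigzag-odd t k 1
  ... | no  t≮p = s + s , +-mono-≤ s≤p s≤p , trans (zigzag-even s k 1) (m∸[m∸n]≡n w≤k)
    where
    s : ℕ
    s = k ∸ suc t
    s≤p : s ≤ p
    s≤p = ≤-trans (∸-monoʳ-≤ k (≰⇒> t≮p)) (≤-reflexive (m+n∸m≡n (suc p) p))

  joinLabel-onto : ∀ {w} → k < w → w ≤ k + N * k → ∃ λ i → ∃ λ j → i < N × j < k × joinLabel i j ≡ w
  joinLabel-onto {w} k<w w≤ = i , j , i<N , j<k , (begin
    k + boustrophedon k i j   ≡⟨ cong (k +_) bous≡ ⟩
    k + (i * k + suc r)       ≡⟨ cong (k +_) (+-suc (i * k) r) ⟩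
    k + suc (i * k + r)       ≡⟨ cong (λ x → k + suc x) (trans (+-comm (i * k) r) (sym (m≡m%n+[m/n]*n v k))) ⟩
    k + suc v                 ≡⟨ +-suc k v ⟩
    suc k + v                 ≡⟨ m+[n∸m]≡n k<w ⟩
    w                         ∎)
    where
    open ≡-Reasoning
    v : ℕ
    v = w ∸ suc k
    v<Nk : v < N * k
    v<Nk = subst (v <_) (m+n∸m≡n k (N * k)) (≤-trans (≤-reflexive (sym (+-∸-assoc 1 k<w))) (∸-monoˡ-≤ k w≤))
    i r : ℕ
    i = v / k
    r = v % k
    i<N : i < N
    i<N = m<n*o⇒m/o<n v<Nk
    decoded = boustrophedon-decode k i (m%n<n v k)
    j = proj₁ decoded
    j<k = proj₁ (proj₂ decoded)
    bous≡ = proj₂ (proj₂ decoded)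

  cliqueLabel-onto : ∀ {w} → k + N * k < w → w ≤ k + N * k + triangle N →
    ∃ λ i → ∃ λ j → i < j × j < N × cliqueLabel i j ≡ w
  cliqueLabel-onto {w} J<w w≤ with triangle-decode N v<T
    where
    v : ℕ
    v = w ∸ suc (k + N * k)
    v<T : v < triangle N
    v<T = subst (v <_) (m+n∸m≡n (k + N * k) (triangle N))
            (≤-trans (≤-reflexive (sym (+-∸-assoc 1 J<w))) (∸-monoˡ-≤ (k + N * k) w≤))
  ... | j , i , i<j , j<N , eq = i , j , i<j , j<N ,
    trans (cong suc (+-assoc (k + N * k) (triangle j) i)) (trans (cong (λ x → suc (k + N * k + x)) eq) (m+[n∸m]≡n J<w))

  edgeLabel-range : ∀ {e} → e ∈ edges G → 0 < edgeLabel e × edgeLabel e ≤ E G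
  edgeLabel-range {e} e∈ = subst (λ q → 0 < edgeLabel e × edgeLabel e ≤ q) (sym E-G) (range (edgeView e∈))
    where
    k≤total : k ≤ triangle N + (k + N * k)
    k≤total = ≤-trans (m≤m+n k (N * k)) (m≤n+m _ (triangle N))
    range : ∀ {e} → EdgeView e → 0 < edgeLabel e × edgeLabel e ≤ triangle N + (k + N * k)
    range (cliqueEdge {i} {j} i<j j<N) rewrite edgeLabel-clique i j<N = s≤s z≤n , (begin
      suc (k + N * k + triangle j + i)     ≡⟨ cong suc (+-assoc (k + N * k) (triangle j) i) ⟩
      suc (k + N * k + (triangle j + i))   ≡⟨ sym (+-suc (k + N * k) _) ⟩
      k + N * k + suc (triangle j + i)     ≤⟨ +-monoʳ-≤ (k + N * k) (triangle-+-< i<j j<N) ⟩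
      k + N * k + triangle N               ≡⟨ +-comm (k + N * k) (triangle N) ⟩
      triangle N + (k + N * k)             ∎)
      where open ≤-Reasoning
    range (cycleEdge {i} i<2p) rewrite edgeLabel-cycle i (suc i) =
      let pos , ≤k = cycleLabel-range (<⇒≤ i<2p) in pos , ≤-trans ≤k k≤total
    range closingEdge rewrite edgeLabel-cycle (p + p) 0 =
      let pos , ≤k = cycleLabel-range ≤-refl in pos , ≤-trans ≤k k≤total
    range (joinEdge {i} {j} i<N j<k) rewrite edgeLabel-join j i<N = s≤s z≤n , (begin
      k + boustrophedon k i j              ≤⟨ +-monoʳ-≤ k (boustrophedon-≤ k i j<k) ⟩
      k + suc i * k                        ≤⟨ +-monoʳ-≤ k (*-monoˡ-≤ k i<N) ⟩
      k + N * k                            ≤⟨ m≤n+m _ (triangle N) ⟩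
      triangle N + (k + N * k)             ∎)
      where open ≤-Reasoning

  edgeLabel-onto : ∀ {w} → 0 < w → w ≤ E G → ∃ λ e → e ∈ edges G × edgeLabel e ≡ w
  edgeLabel-onto {w} 0<w w≤E with w ≤? k
  ... | yes w≤k with cycleLabel-onto 0<w w≤k
  ...   | i , i≤2p , eq with m≤n⇒m<n∨m≡n i≤2p
  ...     | inj₁ i<2p = _ , cycleEdge-∈ i<2p , trans (edgeLabel-cycle i (suc i)) eq
  ...     | inj₂ refl = _ , closingEdge-∈ , trans (edgeLabel-cycle (p + p) 0) eq
  edgeLabel-onto {w} 0<w w≤E | no w≰k with w ≤? k + N * k
  ... | yes w≤J = let i , j , i<N , j<k , eq = joinLabel-onto (≰⇒> w≰k) w≤J in
    _ , joinEdge-∈ i<N j<k , trans (edgeLabel-join j i<N) eq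
  ... | no  w≰J = let i , j , i<j , j<N , eq = cliqueLabel-onto (≰⇒> w≰J) w≤total in
    _ , cliqueEdge-∈ i<j j<N , trans (edgeLabel-clique i j<N) eq
    where
    w≤total : w ≤ k + N * k + triangle N
    w≤total = ≤-trans w≤E (≤-reflexive (trans E-G (+-comm (triangle N) (k + N * k))))

  σ : Labeling G
  σ = proj₁ (labeling-fromEdgeLabels G edgeLabel edgeLabel-range edgeLabel-onto)

  label-σ : ∀ x → label G σ x ≡ edgeLabel (edge G x)
  label-σ = proj₂ (labeling-fromEdgeLabels G edgeLabel edgeLabel-range edgeLabel-onto)

  weight : ℕ → ℕ × ℕ → ℕ
  weight v e = when (incident v e) (edgeLabel e)

  weight-≢snd : ∀ v a {b} → v ≢ b → weight v (a , b) ≡ when (v ≡ᵇ a) (edgeLabel (a , b))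
  weight-≢snd v a {b} v≢b rewrite incident-≡ᵇ v a b | dec-false (v ≟ b) v≢b | ∨-identityʳ (v ≡ᵇ a) = refl

  weight-≢fst : ∀ v {a} b → v ≢ a → weight v (a , b) ≡ when (v ≡ᵇ b) (edgeLabel (a , b))
  weight-≢fst v {a} b v≢a rewrite incident-≡ᵇ v a b | dec-false (v ≟ a) v≢a = refl

  weight-away : ∀ v a b → v ≢ a → v ≢ b → weight v (a , b) ≡ 0
  weight-away v a b v≢a v≢b =
    trans (weight-≢fst v b v≢a) (cong (λ c → when c (edgeLabel (a , b))) (dec-false (v ≟ b) v≢b))

  weight-snd : ∀ v a → weight v (a , v) ≡ edgeLabel (a , v)
  weight-snd v a rewrite incident-≡ᵇ v a v | dec-true (v ≟ v) refl | ∨-zeroʳ (v ≡ᵇ a) = refl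

  cliqueSum cycleSum joinSum : ℕ → ℕ
  cliqueSum v = ∑[ j < N ] ∑[ i < j ] weight v (i , j)
  cycleSum  v = ∑[ i < p + p ] weight v (N + i , N + suc i) + (weight v (N + (p + p) , N + 0) + 0)
  joinSum   v = ∑[ i < N ] ∑[ j < k ] weight v (i , N + j)

  vsum-split : ∀ v → vsum G σ v ≡ cliqueSum v + (cycleSum v + joinSum v)
  vsum-split v = begin
    vsum G σ v                                                       ≡⟨ vsum-byEdges G σ edgeLabel label-σ v ⟩
    sum (map (weight v) (cliqueEdges ++ (cycleEdges ++ joinEdges)))   ≡⟨ sum-map-++ (weight v) cliqueEdges _ ⟩
    sum (map (weight v) cliqueEdges) + sum (map (weight v) (cycleEdges ++ joinEdges))
      ≡⟨ cong₂ _+_ (sum-map-rows (weight v) N id _) (sum-map-++ (weight v) cycleEdges _) ⟩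
    cliqueSum v + (sum (map (weight v) cycleEdges) + sum (map (weight v) joinEdges))
      ≡⟨ cong (cliqueSum v +_) (cong₂ _+_ cycle (sum-map-rows (weight v) N (λ _ → k) _)) ⟩
    cliqueSum v + (cycleSum v + joinSum v) ∎
    where
    open ≡-Reasoning
    cycle : sum (map (weight v) cycleEdges) ≡ cycleSum v
    cycle = begin
      sum (map (weight v) (map shift (cyclePath ++ (p + p , 0) ∷ [])))   ≡⟨ cong sum (sym (map-∘ (cyclePath ++ _))) ⟩
      sum (map (weight v ∘ shift) (cyclePath ++ (p + p , 0) ∷ []))        ≡⟨ sum-map-++ (weight v ∘ shift) cyclePath _ ⟩
      sum (map (weight v ∘ shift) cyclePath) + (weight v (shift (p + p , 0)) + 0)
        ≡⟨ cong (_+ (weight v (shift (p + p , 0)) + 0)) (sum-map-map-upTo (weight v ∘ shift) (λ i → (i , suc i)) (p + p)) ⟩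
      cycleSum v ∎

  clique≢cycle : ∀ {x} y → x < N → x ≢ N + y
  clique≢cycle y x<N refl = m+n≮m N y x<N

  cliqueDegreeSum rowSum : ℕ → ℕ
  cliqueDegreeSum x = ∑[ i < x ] cliqueLabel i x + ∑[ d < N ∸ suc x ] cliqueLabel x (x + suc d)
  rowSum x = ∑[ j < k ] joinLabel x j

  cliqueVertexSum : ℕ → ℕ
  cliqueVertexSum x = cliqueDegreeSum x + rowSum x

  cliqueSum-clique : ∀ {x} → x < N → cliqueSum x ≡ cliqueDegreeSum x
  cliqueSum-clique {x} x<N = begin
    ∑ N F                                                ≡⟨ cong (λ L → ∑ L F) N≡x+1+r ⟩
    ∑ (x + suc r) F                                      ≡⟨ ∑-split x (suc r) F ⟩
    ∑ x F + (F (x + 0) + ∑[ d < r ] F (x + suc d))       ≡⟨ cong₂ _+_ below (cong₂ _+_ at above) ⟩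
    0 + cliqueDegreeSum x                                ∎
    where
    open ≡-Reasoning
    r : ℕ
    r = N ∸ suc x
    N≡x+1+r : N ≡ x + suc r
    N≡x+1+r = trans (sym (m+[n∸m]≡n x<N)) (sym (+-suc x r))
    F : ℕ → ℕ
    F j = ∑[ i < j ] weight x (i , j)
    below : ∑ x F ≡ 0
    below = ∑-vanish x λ {j} j<x → ∑-vanish j λ {i} i<j →
      weight-away x i j (λ { refl → <-asym i<j j<x }) (λ { refl → n≮n j j<x })
    at : F (x + 0) ≡ ∑[ i < x ] cliqueLabel i x
    at = trans (cong F (+-identityʳ x)) (∑-cong x λ {i} _ → trans (weight-snd x i) (edgeLabel-clique i x<N))
    above : ∑[ d < r ] F (x + suc d) ≡ ∑[ d < r ] cliqueLabel x (x + suc d)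
    above = ∑-cong r λ {d} d<r →
      let j = x + suc d
          x<j = m<m+n x (s≤s z≤n)
          j<N = subst (j <_) (sym N≡x+1+r) (+-monoʳ-< x (s≤s d<r))
      in begin
        ∑[ i < j ] weight x (i , j)                     ≡⟨ ∑-cong j (λ {i} _ → weight-≢snd x i (<⇒≢ x<j)) ⟩
        ∑[ i < j ] when (x ≡ᵇ i) (edgeLabel (i , j))    ≡⟨ ∑-indicator j (λ i → edgeLabel (i , j)) x<j ⟩
        edgeLabel (x , j)                               ≡⟨ edgeLabel-clique x j<N ⟩
        cliqueLabel x j                                 ∎

  joinSum-clique : ∀ {x} → x < N → joinSum x ≡ rowSum x
  joinSum-clique {x} x<N = begin
    ∑[ i < N ] ∑[ j < k ] weight x (i , N + j)                ≡⟨ ∑-cong N (λ i<N → ∑-cong k (λ {j} _ → row i<N j)) ⟩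
    ∑[ i < N ] ∑[ j < k ] when (x ≡ᵇ i) (joinLabel i j)       ≡⟨ ∑-cong N (λ {i} _ → ∑-when k (x ≡ᵇ i) (joinLabel i)) ⟩
    ∑[ i < N ] when (x ≡ᵇ i) (rowSum i)                       ≡⟨ ∑-indicator N rowSum x<N ⟩
    rowSum x                                                  ∎
    where
    open ≡-Reasoning
    row : ∀ {i} → i < N → ∀ j → weight x (i , N + j) ≡ when (x ≡ᵇ i) (joinLabel i j)
    row {i} i<N j = trans (weight-≢snd x i (clique≢cycle j x<N)) (cong (when (x ≡ᵇ i)) (edgeLabel-join j i<N))

  cycleSum-clique : ∀ {x} → x < N → cycleSum x ≡ 0
  cycleSum-clique {x} x<N = cong₂ _+_
    (∑-vanish (p + p) λ {i} _ → weight-away x (N + i) (N + suc i) (clique≢cycle i x<N) (clique≢cycle (suc i) x<N))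
    (cong (_+ 0) (weight-away x (N + (p + p)) (N + 0) (clique≢cycle (p + p) x<N) (clique≢cycle 0 x<N)))

  vsum-clique : ∀ {x} → x < N → vsum G σ x ≡ cliqueVertexSum x
  vsum-clique {x} x<N = trans (vsum-split x)
    (cong₂ _+_ (cliqueSum-clique x<N) (cong₂ _+_ (cycleSum-clique x<N) (joinSum-clique x<N)))

  columnSum : ℕ → ℕ
  columnSum y = ∑[ i < N ] joinLabel i y

  cyclePred : ℕ → ℕ
  cyclePred zero    = p + p
  cyclePred (suc y) = y

  cycleWeight : ℕ → ℕ
  cycleWeight y = cycleLabel y + cycleLabel (cyclePred y)

  cliqueSum-cycle : ∀ y → cliqueSum (N + y) ≡ 0
  cliqueSum-cycle y = ∑-vanish N λ {j} j<N → ∑-vanish j λ {i} i<j →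
    weight-away (N + y) i j (clique≢cycle y (<-trans i<j j<N) ∘ sym) (clique≢cycle y j<N ∘ sym)

  joinSum-cycle : ∀ {y} → y < k → joinSum (N + y) ≡ columnSum y
  joinSum-cycle {y} y<k = ∑-cong N λ {i} i<N → begin
    ∑[ j < k ] weight (N + y) (i , N + j)              ≡⟨ ∑-cong k (λ {j} _ → column i<N j) ⟩
    ∑[ j < k ] when (y ≡ᵇ j) (joinLabel i j)           ≡⟨ ∑-indicator k (joinLabel i) y<k ⟩
    joinLabel i y                                      ∎
    where
    open ≡-Reasoning
    column : ∀ {i} → i < N → ∀ j → weight (N + y) (i , N + j) ≡ when (y ≡ᵇ j) (joinLabel i j)
    column {i} i<N j rewrite weight-≢fst (N + y) (N + j) (clique≢cycle y i<N ∘ sym) | ≡ᵇ-+ N y j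
                           | edgeLabel-join j i<N = refl

  weight-cycle : ∀ y a b → weight (N + y) (N + a , N + b) ≡ when ((y ≡ᵇ a) ∨ (y ≡ᵇ b)) (cycleLabel a)
  weight-cycle y a b rewrite incident-≡ᵇ (N + y) (N + a) (N + b) | ≡ᵇ-+ N y a | ≡ᵇ-+ N y b
                           | edgeLabel-cycle a b = refl

  cycleSum-cycle : ∀ {y} → y < k → cycleSum (N + y) ≡ cycleWeight y
  cycleSum-cycle {y} y<k = begin
    cycleSum (N + y)
      ≡⟨ cong₂ _+_ (∑-cong (p + p) λ {i} _ → trans (weight-cycle y i (suc i)) (when-∨ {y} (cycleLabel i) (<⇒≢ (n<1+n i))))
                   (cong (_+ 0) (trans (weight-cycle y (p + p) 0) (when-∨ {y} (cycleLabel (p + p)) 2p≢0))) ⟩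
    ∑[ i < p + p ] (from i + to i) + ((from′ + to′) + 0)
      ≡⟨ cong (_+ ((from′ + to′) + 0)) (∑-distrib-+ (p + p) from to) ⟩
    ∑ (p + p) from + ∑ (p + p) to + ((from′ + to′) + 0)
      ≡⟨ regroup (∑ (p + p) from) (∑ (p + p) to) from′ to′ ⟩
    (∑ (p + p) from + from′) + (∑ (p + p) to + to′)
      ≡⟨ cong₂ _+_ (trans (sym (∑-last (p + p) from)) (∑-indicator k cycleLabel y<k)) (predecessor y y<k) ⟩
    cycleWeight y ∎
    where
    open ≡-Reasoning
    2p≢0 : p + p ≢ 0
    2p≢0 ()
    from to : ℕ → ℕ
    from i = when (y ≡ᵇ i) (cycleLabel i)
    to   i = when (y ≡ᵇ suc i) (cycleLabel i)
    from′ to′ : ℕ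
    from′ = when (y ≡ᵇ p + p) (cycleLabel (p + p))
    to′   = when (y ≡ᵇ 0) (cycleLabel (p + p))
    regroup : ∀ a b c d → a + b + ((c + d) + 0) ≡ (a + c) + (b + d)
    regroup = solve-∀
    predecessor : ∀ y → y < k → ∑[ i < p + p ] when (y ≡ᵇ suc i) (cycleLabel i) + when (y ≡ᵇ 0) (cycleLabel (p + p))
                              ≡ cycleLabel (cyclePred y)
    predecessor zero    _             = cong (_+ cycleLabel (p + p)) (∑-vanish (p + p) (λ _ → refl))
    predecessor (suc z) (s≤s z<2p)    = trans (+-identityʳ _) (∑-indicator (p + p) cycleLabel z<2p)

  vsum-cycle : ∀ {y} → y < k → vsum G σ (N + y) ≡ cycleWeight y + columnSum y
  vsum-cycle {y} y<k = trans (vsum-split (N + y))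
    (cong₂ _+_ (cliqueSum-cycle y) (cong₂ _+_ (cycleSum-cycle y<k) (joinSum-cycle y<k)))

  cliqueLabel-mono : ∀ {i i′ j j′} → i ≤ i′ → j ≤ j′ → cliqueLabel i j ≤ cliqueLabel i′ j′
  cliqueLabel-mono i≤ j≤ = s≤s (+-mono-≤ (+-monoʳ-≤ (k + N * k) (triangle-mono j≤)) i≤)

  cliqueDegreeSum-mono : ∀ {x} → suc x < N → cliqueDegreeSum x ≤ cliqueDegreeSum (suc x)
  cliqueDegreeSum-mono {x} 1+x<N = begin
    cliqueDegreeSum x
      ≡⟨ cong (λ L → ∑[ i < x ] cliqueLabel i x + ∑[ d < L ] cliqueLabel x (x + suc d)) (∸-suc-< N 1+x<N) ⟩
    ∑[ i < x ] cliqueLabel i x + (cliqueLabel x (x + 1) + ∑[ d < r ] cliqueLabel x (x + suc (suc d)))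
      ≤⟨ +-mono-≤ (∑-mono-≤ x λ _ → cliqueLabel-mono ≤-refl (n≤1+n x))
                  (+-mono-≤ (cliqueLabel-mono ≤-refl (≤-reflexive (+-comm x 1)))
                            (∑-mono-≤ r λ {d} _ → cliqueLabel-mono (n≤1+n x) (≤-reflexive (+-suc x (suc d))))) ⟩
    ∑[ i < x ] cliqueLabel i (suc x) + (cliqueLabel x (suc x) + ∑[ d < r ] cliqueLabel (suc x) (suc x + suc d))
      ≡⟨ sym (+-assoc (∑[ i < x ] cliqueLabel i (suc x)) (cliqueLabel x (suc x)) _) ⟩
    ∑[ i < x ] cliqueLabel i (suc x) + cliqueLabel x (suc x) + ∑[ d < r ] cliqueLabel (suc x) (suc x + suc d)
      ≡⟨ cong (_+ ∑[ d < r ] cliqueLabel (suc x) (suc x + suc d)) (sym (∑-last x (λ i → cliqueLabel i (suc x)))) ⟩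
    cliqueDegreeSum (suc x) ∎
    where
    open ≤-Reasoning
    r : ℕ
    r = N ∸ suc (suc x)
    ∸-suc-< : ∀ b {a} → a < b → b ∸ a ≡ suc (b ∸ suc a)
    ∸-suc-< (suc b) {zero}  _         = refl
    ∸-suc-< (suc b) {suc a} (s≤s a<b) = ∸-suc-< b a<b

  rowSum-< : ∀ x → rowSum x < rowSum (suc x)
  rowSum-< x = ∑-mono-< k (s≤s z≤n) λ j<k → +-monoʳ-< k (boustrophedon-< k x j<k)

  cliqueVertexSum-suc : ∀ {j} → suc j < N → cliqueVertexSum j < cliqueVertexSum (suc j)
  cliqueVertexSum-suc {j} 1+j<N = +-mono-≤-< (cliqueDegreeSum-mono 1+j<N) (rowSum-< j)

  cliqueVertexSum-< : ∀ {i j} → i < j → j < N → cliqueVertexSum i < cliqueVertexSum j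
  cliqueVertexSum-< {i} {suc j} i<1+j 1+j<N with m≤n⇒m<n∨m≡n (≤-pred i<1+j)
  ... | inj₁ i<j = <-trans (cliqueVertexSum-< i<j (<-trans (n<1+n j) 1+j<N)) (cliqueVertexSum-suc 1+j<N)
  ... | inj₂ refl = cliqueVertexSum-suc 1+j<N

  cliqueVertexSum-≥ : ∀ {x} → x < N → (N ∸ 1) * suc (k + N * k) + k * suc k ≤ cliqueVertexSum x
  cliqueVertexSum-≥ {x} x<N = ≤-trans (+-mono-≤ clique-edges join-edges) (at-least-0 x x<N)
    where
    clique-edges : (N ∸ 1) * suc (k + N * k) ≤ cliqueDegreeSum 0
    clique-edges = *≤∑ (N ∸ 1) _ λ {d} _ → s≤s (≤-trans (m≤m+n (k + N * k) (triangle (suc d))) (m≤m+n _ 0))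
    join-edges : k * suc k ≤ rowSum 0
    join-edges = *≤∑ k _ λ {j} _ → ≤-trans (s≤s (m≤m+n k j)) (≤-reflexive (sym (+-suc k j)))
    at-least-0 : ∀ x → x < N → cliqueVertexSum 0 ≤ cliqueVertexSum x
    at-least-0 zero    _     = ≤-refl
    at-least-0 (suc x) 1+x<N = <⇒≤ (cliqueVertexSum-< (s≤s z≤n) 1+x<N)

  columnTotal : ℕ
  columnTotal = ∑[ t < n ] (k + k + (t + t) * k + (t + t) * k + suc (k + k))

  columnSum-const : ∀ {y} → y < k → columnSum y ≡ columnTotal
  columnSum-const {y} y<k = trans (∑-pairs n (λ i → joinLabel i y)) (∑-cong n λ {t} _ → begin
    joinLabel (t + t) y + joinLabel (suc (t + t)) y
      ≡⟨ cong₂ (λ a b → (k + a) + (k + b)) (boustrophedon-even k t y) (boustrophedon-odd k t y) ⟩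
    (k + ((t + t) * k + suc y)) + (k + ((t + t) * k + (k + k ∸ y)))
      ≡⟨ regroup k ((t + t) * k) y (k + k ∸ y) ⟩
    k + k + (t + t) * k + (t + t) * k + suc (y + (k + k ∸ y))
      ≡⟨ cong (λ s → k + k + (t + t) * k + (t + t) * k + suc s) (m+[n∸m]≡n (≤-trans (<⇒≤ y<k) (m≤m+n k k))) ⟩
    k + k + (t + t) * k + (t + t) * k + suc (k + k) ∎)
    where
    open ≡-Reasoning
    regroup : ∀ k a y u → (k + (a + suc y)) + (k + (a + u)) ≡ k + k + a + a + suc (y + u)
    regroup = solve-∀

  columnTotal-≤ : columnTotal ≤ n * ((n + n) * k + (n + n) * k + 1)
  columnTotal-≤ = ∑≤* n _ λ {t} t<n → begin
    k + k + (t + t) * k + (t + t) * k + suc (k + k)     ≡⟨ regroup k t ⟩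
    (suc t + suc t) * k + (suc t + suc t) * k + 1       ≤⟨ +-monoˡ-≤ 1 (+-mono-≤ (rows≤ t<n) (rows≤ t<n)) ⟩
    (n + n) * k + (n + n) * k + 1                       ∎
    where
    open ≤-Reasoning
    rows≤ : ∀ {t} → t < n → (suc t + suc t) * k ≤ (n + n) * k
    rows≤ t<n = *-monoˡ-≤ k (+-mono-≤ t<n t<n)
    regroup : ∀ k t → k + k + (t + t) * k + (t + t) * k + suc (k + k) ≡ (suc t + suc t) * k + (suc t + suc t) * k + 1
    regroup = solve-∀

  cycleWeight-zero : cycleWeight 0 ≡ k + suc p
  cycleWeight-zero = cong (k +_) (trans (zigzag-even p k 1) (m+n∸n≡m (suc p) p))

  cycleWeight-suc : ∀ {z} → z < p + p → cycleWeight (suc z) + parity z ≡ suc k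
  cycleWeight-suc {z} z<2p = begin
    cycleLabel (suc z) + cycleLabel z + parity z   ≡⟨ cong (_+ parity z) (+-comm (cycleLabel (suc z)) (cycleLabel z)) ⟩
    cycleLabel z + cycleLabel (suc z) + parity z   ≡⟨ zigzag-adjacent k 1 (<-trans z<2p (≤-trans (n<1+n (p + p)) (m≤m+n k k))) ⟩
    k + 1                                          ≡⟨ +-comm k 1 ⟩
    suc k                                          ∎
    where open ≡-Reasoning

  cycleWeight-≤ : ∀ {y} → y < k → cycleWeight y ≤ k + suc p
  cycleWeight-≤ {zero}  _          = ≤-reflexive cycleWeight-zero
  cycleWeight-≤ {suc z} (s≤s z<2p) = begin
    cycleWeight (suc z)              ≤⟨ m≤m+n _ (parity z) ⟩
    cycleWeight (suc z) + parity z   ≡⟨ cycleWeight-suc z<2p ⟩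
    suc k                            ≡⟨ +-comm 1 k ⟩
    k + 1                            ≤⟨ +-monoʳ-≤ k (s≤s z≤n) ⟩
    k + suc p                        ∎
    where open ≤-Reasoning

  cycle<clique : ∀ {x y} → x < N → y < k → cycleWeight y + columnTotal < cliqueVertexSum x
  cycle<clique {x} {y} x<N y<k = begin-strict
    cycleWeight y + columnTotal                                        ≤⟨ +-mono-≤ (cycleWeight-≤ y<k) columnTotal-≤ ⟩
    k + suc p + n * ((n + n) * k + (n + n) * k + 1)                    <⟨ m<m+n+1 _ ⟩
    k + suc p + n * ((n + n) * k + (n + n) * k + 1) + slack + 1        ≡⟨ gap n′ p′ ⟩
    (N ∸ 1) * suc (k + N * k) + k * suc k                              ≤⟨ cliqueVertexSum-≥ x<N ⟩
    cliqueVertexSum x                                                  ∎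
    where
    open ≤-Reasoning
    -- slack is the exact difference of the two sides.
    slack : ℕ
    slack = n′ + 4 * p′ * p′ + 9 * p′ + 3
    gap : ∀ a b → let n = suc a ; p = suc b ; k = suc (p + p) ; N = n + n in
      k + suc p + n * (N * k + N * k + 1) + (a + 4 * b * b + 9 * b + 3) + 1 ≡ (a + suc a) * suc (k + N * k) + k * suc k
    gap = solve-∀
    m<m+n+1 : ∀ m → m < m + slack + 1
    m<m+n+1 m = ≤-trans (≤-reflexive (+-comm 1 m)) (+-monoˡ-≤ 1 (m≤m+n m slack))

  cycleWeight-one : cycleWeight 1 ≡ suc k
  cycleWeight-one = trans (sym (+-identityʳ _)) (cycleWeight-suc (s≤s z≤n))

  1<2p : 1 < p + p
  1<2p = s≤s (≤-trans (s≤s z≤n) (m≤n+m (suc p′) p′))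

  cycleWeight-two : cycleWeight 2 ≡ k
  cycleWeight-two = suc-injective (trans (+-comm 1 (cycleWeight 2)) (cycleWeight-suc 1<2p))

  1+k<cycleWeight-zero : suc k < cycleWeight 0
  1+k<cycleWeight-zero = begin-strict
    suc k         ≡⟨ +-comm 1 k ⟩
    k + 1         <⟨ +-monoʳ-< k (s≤s (s≤s z≤n)) ⟩
    k + suc p     ≡⟨ sym cycleWeight-zero ⟩
    cycleWeight 0 ∎
    where open ≤-Reasoning

  parity≡⇒cycleWeight-suc≡ : ∀ {z z′} → z < p + p → z′ < p + p →
    parity z ≡ parity z′ → cycleWeight (suc z) ≡ cycleWeight (suc z′)
  parity≡⇒cycleWeight-suc≡ {z} {z′} z<2p z′<2p eq = +-cancelʳ-≡ (parity z) _ _ (begin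
    cycleWeight (suc z) + parity z     ≡⟨ cycleWeight-suc z<2p ⟩
    suc k                              ≡⟨ sym (cycleWeight-suc z′<2p) ⟩
    cycleWeight (suc z′) + parity z′   ≡⟨ cong (cycleWeight (suc z′) +_) (sym eq) ⟩
    cycleWeight (suc z′) + parity z    ∎)
    where open ≡-Reasoning

  cycleWeight-suc≡⇒parity≡ : ∀ {z z′} → z < p + p → z′ < p + p →
    cycleWeight (suc z) ≡ cycleWeight (suc z′) → parity z ≡ parity z′
  cycleWeight-suc≡⇒parity≡ {z} {z′} z<2p z′<2p eq = +-cancelˡ-≡ (cycleWeight (suc z)) _ _ (begin
    cycleWeight (suc z) + parity z     ≡⟨ cycleWeight-suc z<2p ⟩
    suc k                              ≡⟨ sym (cycleWeight-suc z′<2p) ⟩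
    cycleWeight (suc z′) + parity z′   ≡⟨ cong (_+ parity z′) (sym eq) ⟩
    cycleWeight (suc z) + parity z′    ∎)
    where open ≡-Reasoning

  cycleWeight-adjacent : ∀ {i} → i < p + p → cycleWeight i ≢ cycleWeight (suc i)
  cycleWeight-adjacent {zero}  _      eq = <⇒≢ 1+k<cycleWeight-zero (sym (trans eq cycleWeight-one))
  cycleWeight-adjacent {suc z} 1+z<2p eq = double≢1 (parity z) (trans (cong (parity z +_) same) (parity-+-suc z))
    where
    same : parity z ≡ parity (suc z)
    same = cycleWeight-suc≡⇒parity≡ (<-trans (n<1+n z) 1+z<2p) 1+z<2p eq
    double≢1 : ∀ a → a + a ≢ 1
    double≢1 (suc a) eq = 0≢1+n (sym (suc-injective (trans (cong suc (sym (+-suc a a))) eq)))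

  cycleWeight-closing : cycleWeight (p + p) ≢ cycleWeight 0
  cycleWeight-closing = <⇒≢ (≤-<-trans last≤1+k 1+k<cycleWeight-zero)
    where
    last≤1+k : cycleWeight (p + p) ≤ suc k
    last≤1+k = ≤-trans (m≤m+n _ (parity (p′ + p))) (≤-reflexive (cycleWeight-suc (n<1+n (p′ + p))))

  cycleWeight-three : ∀ {y} → y < k →
    cycleWeight y ∈ cycleWeight 0 ∷ cycleWeight 1 ∷ cycleWeight 2 ∷ []
  cycleWeight-three {zero}  _ = here refl
  cycleWeight-three {suc z} (s≤s z<2p) with parity-0⊎1 z
  ... | inj₁ even = there (here (parity≡⇒cycleWeight-suc≡ z<2p (s≤s z≤n) even))
  ... | inj₂ odd  = there (there (here (parity≡⇒cycleWeight-suc≡ z<2p 1<2p odd)))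

  vsum-cycle-total : ∀ {y} → y < k → vsum G σ (N + y) ≡ cycleWeight y + columnTotal
  vsum-cycle-total {y} y<k = trans (vsum-cycle y<k) (cong (cycleWeight y +_) (columnSum-const y<k))

  vsum-cycle-≡ : ∀ {y y′} → y < k → y′ < k →
    cycleWeight y ≡ cycleWeight y′ → vsum G σ (N + y) ≡ vsum G σ (N + y′)
  vsum-cycle-≡ y<k y′<k eq =
    trans (vsum-cycle-total y<k) (trans (cong (_+ columnTotal) eq) (sym (vsum-cycle-total y′<k)))

  vsum-cycle-≢ : ∀ {y y′} → y < k → y′ < k →
    cycleWeight y ≢ cycleWeight y′ → vsum G σ (N + y) ≢ vsum G σ (N + y′)
  vsum-cycle-≢ {y} {y′} y<k y′<k ≢ eq =
    ≢ (+-cancelʳ-≡ columnTotal _ _ (trans (sym (vsum-cycle-total y<k)) (trans eq (vsum-cycle-total y′<k))))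

  vsum-clique-< : ∀ {i j} → i < j → j < N → vsum G σ i < vsum G σ j
  vsum-clique-< {i} {j} i<j j<N =
    subst₂ _<_ (sym (vsum-clique (<-trans i<j j<N))) (sym (vsum-clique j<N)) (cliqueVertexSum-< i<j j<N)

  vsum-cycle<clique : ∀ {i y} → i < N → y < k → vsum G σ (N + y) < vsum G σ i
  vsum-cycle<clique i<N y<k = subst₂ _<_ (sym (vsum-cycle-total y<k)) (sym (vsum-clique i<N)) (cycle<clique i<N y<k)

  antimagic-σ : IsLocalAntimagic G σ
  antimagic-σ = antimagic-fromEdges G σ (proper ∘ edgeView)
    where
    proper : ∀ {e} → EdgeView e → vsum G σ (proj₁ e) ≢ vsum G σ (proj₂ e)
    proper (cliqueEdge i<j j<N) = <⇒≢ (vsum-clique-< i<j j<N)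
    proper (cycleEdge i<2p)     = vsum-cycle-≢ (<-trans i<2p (n<1+n _)) (s≤s i<2p) (cycleWeight-adjacent i<2p)
    proper closingEdge          = vsum-cycle-≢ (n<1+n _) (s≤s z≤n) cycleWeight-closing
    proper (joinEdge i<N j<k)   = ≢-sym (<⇒≢ (vsum-cycle<clique i<N j<k))

  0<k : 0 < k
  0<k = s≤s z≤n
  2<k : 2 < k
  2<k = s≤s 1<2p
  1<k : 1 < k
  1<k = <-trans (n<1+n 1) 2<k

  colours-σ : numColors G σ ≡ N + 3
  colours-σ = ≤-antisym (CliqueJoinCycle.distinctValues-≤N+3 (vsum G σ) N k three)
    (CliqueJoinCycle.N+3≤distinctValues (vsum G σ) N k 0<k 1<k 2<k
      (λ i<j j<N → <⇒≢ (vsum-clique-< i<j j<N)) (λ i<N y<k → ≢-sym (<⇒≢ (vsum-cycle<clique i<N y<k)))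
      ((v₀≢v₁ ∷ v₀≢v₂ ∷ []) ∷ (v₁≢v₂ ∷ []) ∷ [] ∷ []))
    where
    three : ∀ {y} → y < k → vsum G σ (N + y) ∈ vsum G σ (N + 0) ∷ vsum G σ (N + 1) ∷ vsum G σ (N + 2) ∷ []
    three y<k with cycleWeight-three y<k
    ... | here eq                 = here (vsum-cycle-≡ y<k 0<k eq)
    ... | there (here eq)         = there (here (vsum-cycle-≡ y<k 1<k eq))
    ... | there (there (here eq)) = there (there (here (vsum-cycle-≡ y<k 2<k eq)))
    v₀≢v₁ = vsum-cycle-≢ 0<k 1<k (cycleWeight-adjacent (s≤s z≤n))
    v₁≢v₂ = vsum-cycle-≢ 1<k 2<k (cycleWeight-adjacent 1<2p)
    v₀≢v₂ = vsum-cycle-≢ 0<k 2<k λ eq → <⇒≢ k<cycleWeight-zero (trans (sym cycleWeight-two) (sym eq))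
      where
      k<cycleWeight-zero : k < cycleWeight 0
      k<cycleWeight-zero = <-trans (n<1+n k) 1+k<cycleWeight-zero

  N+3≤colours : ∀ τ → IsLocalAntimagic G τ → N + 3 ≤ numColors G τ
  N+3≤colours τ antimagic =
    CliqueJoinCycle.N+3≤distinctValues (vsum G τ) N k 0<k 1<k y<k
      (λ i<j j<N → proper (cliqueEdge-∈ i<j j<N)) (λ i<N y<k → proper (joinEdge-∈ i<N y<k))
      ((proper (cycleEdge-∈ (s≤s z≤n)) ∷ ≢-sym ≢v₀ ∷ []) ∷ (≢-sym ≢v₁ ∷ []) ∷ [] ∷ [])
    where
    proper = antimagic-onEdges G τ antimagic
    third = oddCycle-thirdValue (λ y → vsum G τ (N + y)) p (λ i<2p → proper (cycleEdge-∈ i<2p)) (proper closingEdge-∈)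
    y = proj₁ third
    y<k = proj₁ (proj₂ third)
    ≢v₀ = proj₁ (proj₂ (proj₂ third))
    ≢v₁ = proj₂ (proj₂ (proj₂ third))

  chiLa : ChiLa G (N + 3)
  chiLa = (σ , antimagic-σ , colours-σ) , N+3≤colours

mainTheorem15 : (m n : ℕ) → 2 ≤ m → 1 ≤ n →
    ChiLa (join (K (2 * n)) (C (2 * m ∸ 1))) (2 * n + 3)
mainTheorem15 (suc (suc p′)) (suc n′) (s≤s (s≤s z≤n)) (s≤s z≤n) =
  subst₂ (λ A B → ChiLa (join (K A) (C B)) (A + 3)) (sym 2n≡) (sym 2m-1≡) (Construction.chiLa n′ p′)
  where
  2n≡ : 2 * suc n′ ≡ suc n′ + suc n′
  2n≡ = cong (suc n′ +_) (+-identityʳ (suc n′))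
  2m-1≡ : 2 * suc (suc p′) ∸ 1 ≡ suc (suc p′ + suc p′)
  2m-1≡ = trans (cong (λ z → suc (suc p′) + z ∸ 1) (+-identityʳ (suc (suc p′)))) (cong suc (+-suc p′ (suc p′)))
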